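{- Let $n_1, n_2$ be integers with $n_1, n_2 \geq 2$ and $\binom{n_1 - \binom{n_2}{2}}{2} \geq n_1$. Then $$\operatorname{sg}(K_{n_1,n_2}) = \begin{cases} n_1, & n_2 = 2,\\ n_1 + n_2 - \binom{n_2}{2}, & n_2 \geq 3.\end{cases}$$
   Context: All graphs are finite, simple and connected. For a graph $G=(V,E)$ and a set $S\subseteq V$, for each pair of distinct vertices $\{x,y\}\subseteq S$ one selects one fixed shortest $x,y$-path $\widetilde g(x,y)$. The set $S$ is a strong geodetic set if for some such choice of fixed shortest paths, every vertex of $G$ lies on at least one of the selected paths. The strong geodetic number $\operatorname{sg}(G)$ is the minimum cardinality of a strong geodetic set of $G$. $K_{n_1,n_2}$ is the complete bipartite graph with parts of sizes $n_1$ and $n_2$. -}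

module Defs where

open import Data.Nat using (ℕ; zero; suc; _+_; _≤_)
open import Data.Fin as Fin using (Fin)
open import Data.Sum using (_⊎_; inj₁; inj₂)
open import Data.Product using (Σ; ∃; ∃-syntax; _×_; _,_)
open import Data.Empty using (⊥)
open import Data.Unit using (⊤)
open import Data.List using (List; []; _∷_)
open import Data.List.Membership.Propositional using (_∈_)
open import Function.Definitions using (Injective)
open import Relation.Binary.PropositionalEquality using (_≡_)

record Graph : Set₁ where
  field
    V   : Set
    Adj : V → V → Set

module _ (G : Graph) where
  open Graph G

  data Walk : V → V → Set where
    [_]  : (x : V) → Walk x x
    _∷ʷ_ : ∀ {x y z} → Adj x y → Walk y z → Walk x z

  len : ∀ {x y} → Walk x y → ℕ
  len [ x ]      = 0
  len (e ∷ʷ w)   = suc (len w)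

  verts : ∀ {x y} → Walk x y → List V
  verts [ x ] = x ∷ []
  verts (_∷ʷ_ {x = x} e w) = x ∷ verts w

  IsGeodesic : ∀ {x y} → Walk x y → Set
  IsGeodesic {x} {y} w = ∀ (w' : Walk x y) → len w ≤ len w'

  Geodesic : V → V → Set
  Geodesic x y = Σ (Walk x y) IsGeodesic

  -- S : Fin k → V injective is a k-element vertex set; for each unordered
  -- pair {S i, S j} (represented once, by i < j) one geodesic is fixed,
  -- and every vertex lies on one of the fixed geodesics.
  IsStrongGeodeticSet : (k : ℕ) → (Fin k → V) → Set
  IsStrongGeodeticSet k S =
    Injective _≡_ _≡_ S ×
    Σ ((i j : Fin k) → i Fin.< j → Geodesic (S i) (S j)) λ g →
      ∀ (v : V) → ∃[ i ] ∃[ j ] Σ (i Fin.< j) λ i<j →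
        v ∈ verts (Data.Product.proj₁ (g i j i<j))

  HasStrongGeodeticSetOfSize : ℕ → Set
  HasStrongGeodeticSetOfSize k = Σ (Fin k → V) (IsStrongGeodeticSet k)

  StrongGeodeticNumber : ℕ → Set
  StrongGeodeticNumber m =
    HasStrongGeodeticSetOfSize m ×
    (∀ k → HasStrongGeodeticSetOfSize k → m ≤ k)

KAdj : ∀ {n₁ n₂} → (Fin n₁ ⊎ Fin n₂) → (Fin n₁ ⊎ Fin n₂) → Set
KAdj (inj₁ _) (inj₁ _) = ⊥
KAdj (inj₁ _) (inj₂ _) = ⊤
KAdj (inj₂ _) (inj₁ _) = ⊤
KAdj (inj₂ _) (inj₂ _) = ⊥

K : ℕ → ℕ → Graph
K n₁ n₂ = record { V = Fin n₁ ⊎ Fin n₂ ; Adj = KAdj }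

module Submission where

-- Geodesics of K n₁ n₂ have length at most 2, so a vertex of the n₁-side outside a strong
-- geodetic set S is the middle vertex of a fixed geodesic between two vertices of S on the
-- n₂-side. If S has a vertices on the n₁-side and b on the n₂-side, then n₁ ≤ a + b C 2 and
-- b ≤ n₂; together with b C 2 ≤ b for b ≤ 2, and b C 2 + n₂ ≤ b + n₂ C 2 for b ≤ n₂ when
-- n₂ ≥ 3, this bounds a + b from below as claimed. The bounds are attained: for n₂ = 2 by the
-- whole n₁-side, two of its pairs having their geodesics through the two n₂-side vertices;
-- for n₂ ≥ 3 by the whole n₂-side and n₁ ∸ n₂ C 2 vertices of the n₁-side, the geodesic of
-- each pair of n₂-side vertices running through its own remaining n₁-side vertex.

open import Defs
open import Data.Nat using (ℕ; zero; suc; _+_; _∸_; _≤_; z≤n; s≤s; z<s)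
open import Data.Nat.Properties
  using (≤-refl; ≤-trans; ≤-reflexive; +-comm; +-assoc; +-suc; +-monoˡ-≤; +-monoʳ-≤;
         m≤n+m; m≤n⇒m<n∨m≡n; m≤n⇒m∸n≡0; ≰⇒>; <⇒≤; m∸n+n≡m; +-∸-comm; m≤n+o⇒m∸n≤o;
         _≤?_; module ≤-Reasoning)
open import Data.Nat.Combinatorics using (_C_; nC1≡n; nCk+nC[k+1]≡[n+1]C[k+1])
open import Data.Fin using (Fin; zero; suc; _<_; _<?_; _↑ˡ_; _↑ʳ_; splitAt; join)
open import Data.Fin.Properties
  using (<-cmp; <-irrefl; <-asym; <-irrelevant; <⇒≢; injective⇒≤; any?; _≟_; +↔⊎;
         ↑ˡ-injective; splitAt-join; join-splitAt)
open import Data.Bool using (Bool; true; false; not; if_then_else_)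
open import Data.Sum using (_⊎_; inj₁; inj₂; map₁)
open import Data.Sum.Properties using (inj₁-injective; inj₂-injective; ≡-dec)
open import Data.Sum.Function.Propositional using (_⊎-↔_)
open import Data.Product using (Σ; Σ-syntax; ∃-syntax; _×_; _,_; proj₁; proj₂)
open import Data.Unit using (tt)
open import Data.List.Relation.Unary.Any using (here; there)
open import Data.List.Membership.Propositional using (_∈_)
open import Function using (_∘_; _↔_; Inverse; mk↔ₛ′)
open import Function.Definitions using (Injective)
open import Function.Properties.Inverse using (↔-refl; ↔-trans)
open import Relation.Binary.Definitions using (tri<; tri≈; tri>)
open import Relation.Binary.PropositionalEquality
  using (_≡_; _≢_; refl; sym; trans; cong; subst; subst₂; module ≡-Reasoning)
open import Relation.Nullary using (¬_; yes; no; contradiction)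

C2-suc : ∀ n → suc n C 2 ≡ n + n C 2
C2-suc n = begin
  suc n C 2      ≡⟨ nCk+nC[k+1]≡[n+1]C[k+1] n 1 ⟨
  n C 1 + n C 2  ≡⟨ cong (_+ n C 2) (nC1≡n n) ⟩
  n + n C 2      ∎
  where open ≡-Reasoning

n≤nC2 : ∀ n → 3 ≤ n → n ≤ n C 2
n≤nC2 (suc n) 3≤1+n with m≤n⇒m<n∨m≡n 3≤1+n
... | inj₂ refl = ≤-refl
... | inj₁ (s≤s 3≤n) = begin
  1 + n          ≤⟨ +-monoˡ-≤ n (≤-trans (s≤s z≤n) 3≤n) ⟩
  n + n          ≤⟨ +-monoʳ-≤ n (n≤nC2 n 3≤n) ⟩
  n + n C 2      ≡⟨ C2-suc n ⟨
  suc n C 2      ∎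
  where open ≤-Reasoning

1≤m⇒mC2+n≤m+nC2 : ∀ {m} n → 1 ≤ m → m ≤ n → m C 2 + n ≤ m + n C 2
1≤m⇒mC2+n≤m+nC2 zero 1≤m m≤0 = contradiction (≤-trans 1≤m m≤0) λ ()
1≤m⇒mC2+n≤m+nC2 {m} (suc n) 1≤m m≤1+n with m≤n⇒m<n∨m≡n m≤1+n
... | inj₂ refl = ≤-reflexive (+-comm (m C 2) m)
... | inj₁ (s≤s m≤n) = begin
  m C 2 + suc n      ≡⟨ +-suc (m C 2) n ⟩
  suc (m C 2 + n)    ≤⟨ s≤s (1≤m⇒mC2+n≤m+nC2 n 1≤m m≤n) ⟩
  1 + (m + n C 2)    ≤⟨ +-monoˡ-≤ (m + n C 2) (≤-trans 1≤m m≤n) ⟩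
  n + (m + n C 2)    ≡⟨ +-comm n (m + n C 2) ⟩
  m + n C 2 + n      ≡⟨ +-assoc m (n C 2) n ⟩
  m + (n C 2 + n)    ≡⟨ cong (m +_) (+-comm (n C 2) n) ⟩
  m + (n + n C 2)    ≡⟨ cong (m +_) (C2-suc n) ⟨
  m + suc n C 2      ∎
  where open ≤-Reasoning

mC2+n≤m+nC2 : ∀ {m n} → 3 ≤ n → m ≤ n → m C 2 + n ≤ m + n C 2
mC2+n≤m+nC2 {zero}      3≤n _   = n≤nC2 _ 3≤n
mC2+n≤m+nC2 {suc _} {n} _   m≤n = 1≤m⇒mC2+n≤m+nC2 n (s≤s z≤n) m≤n

mC2≤m : ∀ {m} → m ≤ 2 → m C 2 ≤ m
mC2≤m {0} _ = z≤n
mC2≤m {1} _ = z≤n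
mC2≤m {2} _ = s≤s z≤n
mC2≤m {suc (suc (suc _))} (s≤s (s≤s ()))

n≤[n∸m]C2⇒m≤n : ∀ {n m} → 1 ≤ n → n ≤ (n ∸ m) C 2 → m ≤ n
n≤[n∸m]C2⇒m≤n {n} {m} 1≤n n≤[n∸m]C2 with m ≤? n
... | yes m≤n = m≤n
... | no  m≰n = contradiction (≤-trans 1≤n (subst (λ d → n ≤ d C 2) n∸m≡0 n≤[n∸m]C2)) λ ()
  where
  n∸m≡0 : n ∸ m ≡ 0
  n∸m≡0 = m≤n⇒m∸n≡0 (<⇒≤ (≰⇒> m≰n))

count : ∀ {k} → (Fin k → Bool) → ℕ
count {zero}  P = 0
count {suc k} P = if P zero then suc (count (P ∘ suc)) else count (P ∘ suc)

prepend : ∀ {c k} (b : Bool) → (Fin c → Fin k) → Fin (if b then suc c else c) → Fin (suc k)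
prepend true  f zero    = zero
prepend true  f (suc x) = suc (f x)
prepend false f x       = suc (f x)

select : ∀ {k} (P : Fin k → Bool) → Fin (count P) → Fin k
select {suc k} P = prepend (P zero) (select (P ∘ suc))

count+count-not : ∀ {k} (P : Fin k → Bool) → count P + count (not ∘ P) ≡ k
count+count-not {zero}  P = refl
count+count-not {suc k} P with P zero
... | true  = cong suc (count+count-not (P ∘ suc))
... | false = trans (+-suc (count (P ∘ suc)) _) (cong suc (count+count-not (P ∘ suc)))

select-sound : ∀ {k} (P : Fin k → Bool) x → P (select P x) ≡ true
select-sound {suc k} P = go (P zero) refl
  where
  go : ∀ b → P zero ≡ b → ∀ x → P (prepend b (select (P ∘ suc)) x) ≡ true
  go true  P0 zero    = P0
  go true  _  (suc x) = select-sound (P ∘ suc) x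
  go false _  x       = select-sound (P ∘ suc) x

select-complete : ∀ {k} (P : Fin k → Bool) i → P i ≡ true → ∃[ x ] select P x ≡ i
select-complete {suc k} P = go (P zero) refl
  where
  go : ∀ b → P zero ≡ b → ∀ i → P i ≡ true → ∃[ x ] prepend b (select (P ∘ suc)) x ≡ i
  go true  _  zero    _  = zero , refl
  go false P0 zero    Pi = contradiction (trans (sym Pi) P0) λ ()
  go true  _  (suc i) Pi with select-complete (P ∘ suc) i Pi
  ... | x , eq = suc x , cong suc eq
  go false _  (suc i) Pi with select-complete (P ∘ suc) i Pi
  ... | x , eq = x , cong suc eq

select-mono : ∀ {k} (P : Fin k → Bool) {x y} → x < y → select P x < select P y
select-mono {suc k} P = go (P zero)
  where
  go : ∀ b {x y} → x < y → prepend b (select (P ∘ suc)) x < prepend b (select (P ∘ suc)) y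
  go true  {zero}  {suc y} _         = z<s
  go true  {suc x} {suc y} (s≤s x<y) = s≤s (select-mono (P ∘ suc) x<y)
  go false x<y = s≤s (select-mono (P ∘ suc) x<y)

module _ {m n} {f : Fin m → Fin n} (f-mono : ∀ {x y} → x < y → f x < f y) where

  mono⇒injective : Injective _≡_ _≡_ f
  mono⇒injective {x} {y} fx≡fy with <-cmp x y
  ... | tri< x<y _ _ = contradiction fx≡fy (<⇒≢ (f-mono x<y))
  ... | tri≈ _ x≡y _ = x≡y
  ... | tri> _ _ y<x = contradiction (sym fx≡fy) (<⇒≢ (f-mono y<x))

  mono⇒reflects-< : ∀ {x y} → f x < f y → x < y
  mono⇒reflects-< {x} {y} fx<fy with <-cmp x y
  ... | tri< x<y _ _ = x<y
  ... | tri≈ _ refl _ = contradiction fx<fy (<-irrefl refl)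
  ... | tri> _ _ y<x = contradiction fx<fy (<-asym (f-mono y<x))

covering⇒≤ : ∀ {m n} {X : Set} (f : Fin m → X) (g : Fin n → X) → Injective _≡_ _≡_ g →
             (∀ y → ∃[ x ] f x ≡ g y) → n ≤ m
covering⇒≤ f g g-injective cover = injective⇒≤ λ {y} {y′} eq →
  g-injective (trans (sym (proj₂ (cover y))) (trans (cong f eq) (proj₂ (cover y′))))

splitAt-injective : ∀ m {n} → Injective _≡_ _≡_ (splitAt m {n})
splitAt-injective m {n} {i} {j} eq = begin
  i                      ≡⟨ join-splitAt m n i ⟨
  join m n (splitAt m i) ≡⟨ cong (join m n) eq ⟩
  join m n (splitAt m j) ≡⟨ join-splitAt m n j ⟩
  j                      ∎
  where open ≡-Reasoning

↑ʳ-mono-< : ∀ m {n} {i j : Fin n} → i < j → m ↑ʳ i < m ↑ʳ j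
↑ʳ-mono-< zero    i<j = i<j
↑ʳ-mono-< (suc m) i<j = s≤s (↑ʳ-mono-< m i<j)

Pair : ℕ → Set
Pair n = Σ[ x ∈ Fin n ] Σ[ y ∈ Fin n ] x < y

Fin⊎Pair↔Pair-suc : ∀ {n} → (Fin n ⊎ Pair n) ↔ Pair (suc n)
Fin⊎Pair↔Pair-suc = mk↔ₛ′ to from to-from from-to
  where
  to : Fin _ ⊎ Pair _ → Pair _
  to (inj₁ y)             = zero , suc y , z<s
  to (inj₂ (x , y , x<y)) = suc x , suc y , s≤s x<y

  from : Pair _ → Fin _ ⊎ Pair _
  from (zero  , suc y , _)         = inj₁ y
  from (suc x , suc y , s≤s x<y) = inj₂ (x , y , x<y)

  to-from : ∀ p → to (from p) ≡ p
  to-from (zero  , suc y , s≤s z≤n) = refl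
  to-from (suc x , suc y , s≤s x<y) = refl

  from-to : ∀ s → from (to s) ≡ s
  from-to (inj₁ y) = refl
  from-to (inj₂ p) = refl

pairs↔ : ∀ n → Fin (n C 2) ↔ Pair n
pairs↔ zero    = mk↔ₛ′ (λ ()) (λ ()) (λ ()) (λ ())
pairs↔ (suc n) rewrite C2-suc n = ↔-trans +↔⊎ (↔-trans (↔-refl ⊎-↔ pairs↔ n) Fin⊎Pair↔Pair-suc)

module _ (G : Graph) where
  open Graph G

  start∈verts : ∀ {x y} (w : Walk G x y) → x ∈ verts G w
  start∈verts [ x ]    = here refl
  start∈verts (_ ∷ʷ _) = here refl

  end∈verts : ∀ {x y} (w : Walk G x y) → y ∈ verts G w
  end∈verts [ x ]    = here refl
  end∈verts (_ ∷ʷ w) = there (end∈verts w)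

  second : ∀ {x y} → Walk G x y → V
  second [ x ]               = x
  second (_∷ʷ_ {y = v} _ _) = v

  ≢⇒1≤len : ∀ {x y} → x ≢ y → (w : Walk G x y) → 1 ≤ len G w
  ≢⇒1≤len x≢x [ _ ]    = contradiction refl x≢x
  ≢⇒1≤len _   (_ ∷ʷ _) = s≤s z≤n

  ≢∧¬Adj⇒2≤len : ∀ {x y} → x ≢ y → ¬ Adj x y → (w : Walk G x y) → 2 ≤ len G w
  ≢∧¬Adj⇒2≤len x≢x _    [ _ ]             = contradiction refl x≢x
  ≢∧¬Adj⇒2≤len _   ¬xy  (xy ∷ʷ [ _ ])     = contradiction xy ¬xy
  ≢∧¬Adj⇒2≤len _   _    (_ ∷ʷ (_ ∷ʷ _))   = s≤s (s≤s z≤n)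

  edge-geodesic : ∀ {x y} → x ≢ y → Adj x y → Geodesic G x y
  edge-geodesic x≢y xy = xy ∷ʷ [ _ ] , ≢⇒1≤len x≢y

  twoStep-geodesic : ∀ {x z} y → x ≢ z → ¬ Adj x z → Adj x y → Adj y z → Geodesic G x z
  twoStep-geodesic y x≢z ¬xz xy yz = _∷ʷ_ {y = y} xy (yz ∷ʷ [ _ ]) , ≢∧¬Adj⇒2≤len x≢z ¬xz

  interior-of-len≤2 : ∀ {x y u} (w : Walk G x y) → len G w ≤ 2 → u ∈ verts G w →
                      u ≢ x → u ≢ y → Adj x u × Adj u y × second w ≡ u
  interior-of-len≤2 [ _ ]                  _ (here refl)         u≢x _   = contradiction refl u≢x
  interior-of-len≤2 (_ ∷ʷ _)               _ (here refl)         u≢x _   = contradiction refl u≢x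
  interior-of-len≤2 (_ ∷ʷ [ _ ])           _ (there (here refl)) _   u≢y = contradiction refl u≢y
  interior-of-len≤2 (xu ∷ʷ (uy ∷ʷ [ _ ]))  _ (there (here refl)) _   _   = xu , uy , refl
  interior-of-len≤2 (_ ∷ʷ (_ ∷ʷ [ _ ]))    _ (there (there (here refl))) _ u≢y = contradiction refl u≢y
  interior-of-len≤2 (_ ∷ʷ (_ ∷ʷ (_ ∷ʷ _))) (s≤s (s≤s ())) _ _ _

module _ (G : Graph) {k} (S : Fin k → Graph.V G) where

  CoveredBy : ((i j : Fin k) → i < j → Geodesic G (S i) (S j)) → Graph.V G → Set
  CoveredBy g v = ∃[ i ] ∃[ j ] Σ (i < j) λ i<j → v ∈ verts G (proj₁ (g i j i<j))

  endpoint-covered : 2 ≤ k → ∀ g i → CoveredBy g (S i)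
  endpoint-covered (s≤s (s≤s _)) g zero    = zero , suc zero , z<s , start∈verts G _
  endpoint-covered (s≤s (s≤s _)) g (suc i) = zero , suc i , z<s , end∈verts G _

module _ {n₁ n₂ : ℕ} where

  isB : Fin n₁ ⊎ Fin n₂ → Bool
  isB (inj₁ _) = false
  isB (inj₂ _) = true

  isB⇒inj₂ : ∀ {x} → isB x ≡ true → ∃[ q ] x ≡ inj₂ q
  isB⇒inj₂ {inj₂ q} _ = q , refl

  KAdj-sym : ∀ {x y : Fin n₁ ⊎ Fin n₂} → KAdj x y → KAdj y x
  KAdj-sym {inj₁ _} {inj₂ _} _ = tt
  KAdj-sym {inj₂ _} {inj₁ _} _ = tt

  KAdj-A⇒isB : ∀ {x p} → KAdj x (inj₁ {B = Fin n₂} p) → isB x ≡ true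
  KAdj-A⇒isB {inj₂ _} _ = refl

  -- On the same side, the first step of the walk gives a common neighbour of x and y.
  K-shortcut : ∀ {x y} → Walk (K n₁ n₂) x y → Σ[ w ∈ Walk (K n₁ n₂) x y ] len (K n₁ n₂) w ≤ 2
  K-shortcut [ x ]                                   = [ x ] , z≤n
  K-shortcut {inj₁ _} {inj₂ q} (_ ∷ʷ _)              = tt ∷ʷ [ inj₂ q ] , s≤s z≤n
  K-shortcut {inj₂ _} {inj₁ q} (_ ∷ʷ _)              = tt ∷ʷ [ inj₁ q ] , s≤s z≤n
  K-shortcut {inj₁ _} {inj₁ q} (_∷ʷ_ {y = inj₂ m} _ _) = _∷ʷ_ {y = inj₂ m} tt (tt ∷ʷ [ inj₁ q ]) , ≤-refl
  K-shortcut {inj₂ _} {inj₂ q} (_∷ʷ_ {y = inj₁ m} _ _) = _∷ʷ_ {y = inj₁ m} tt (tt ∷ʷ [ inj₂ q ]) , ≤-refl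

  K-geodesic-len≤2 : ∀ {x y} (w : Walk (K n₁ n₂) x y) → IsGeodesic (K n₁ n₂) w →
                     len (K n₁ n₂) w ≤ 2
  K-geodesic-len≤2 w w-geodesic =
    ≤-trans (w-geodesic (proj₁ (K-shortcut w))) (proj₂ (K-shortcut w))

module _ {n₁ n₂ k} (sgs : HasStrongGeodeticSetOfSize (K n₁ n₂) k) where
  private
    S : Fin k → Fin n₁ ⊎ Fin n₂
    S = proj₁ sgs

    S-injective : Injective _≡_ _≡_ S
    S-injective = proj₁ (proj₂ sgs)

    g : (i j : Fin k) → i < j → Geodesic (K n₁ n₂) (S i) (S j)
    g = proj₁ (proj₂ (proj₂ sgs))

    covered : ∀ v → CoveredBy (K n₁ n₂) S g v
    covered = proj₂ (proj₂ (proj₂ sgs))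

    inB : Fin k → Bool
    inB i = isB (S i)

    inA : Fin k → Bool
    inA = not ∘ inB

    open Inverse (pairs↔ (count inB))
      using (strictlyInverseˡ) renaming (to to pairOf; from to codeOf)

    middle : ∀ {i j} → i < j → Fin n₁ ⊎ Fin n₂
    middle {i} {j} i<j = second (K n₁ n₂) (proj₁ (g i j i<j))

    middle-cong : ∀ {i i′ j j′} (i<j : i < j) (i′<j′ : i′ < j′) → i ≡ i′ → j ≡ j′ →
                  middle i<j ≡ middle i′<j′
    middle-cong i<j i′<j′ refl refl = cong middle (<-irrelevant i<j i′<j′)

    decode : Fin (count inA) ⊎ Fin (count inB C 2) → Fin n₁ ⊎ Fin n₂
    decode (inj₁ x) = S (select inA x)
    decode (inj₂ c) = let (x , y , x<y) = pairOf c in middle (select-mono inB x<y)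

    decode-S : ∀ {i v} → S i ≡ inj₁ v → ∃[ s ] decode s ≡ inj₁ v
    decode-S {i} Si≡v =
      let (x , selx≡i) = select-complete inA i (cong (not ∘ isB) Si≡v)
      in inj₁ x , trans (cong S selx≡i) Si≡v

    off-S-is-middle : ∀ {v i j} (i<j : i < j) → (∀ l → S l ≢ inj₁ v) →
                      inj₁ v ∈ verts (K n₁ n₂) (proj₁ (g i j i<j)) →
                      inB i ≡ true × inB j ≡ true × middle i<j ≡ inj₁ v
    off-S-is-middle {v} {i} {j} i<j v∉S v∈w
      with interior-of-len≤2 (K n₁ n₂) (proj₁ (g i j i<j))
             (K-geodesic-len≤2 _ (proj₂ (g i j i<j))) v∈w (v∉S i ∘ sym) (v∉S j ∘ sym)
    ... | Si~v , v~Sj , second≡v = KAdj-A⇒isB Si~v , KAdj-A⇒isB (KAdj-sym v~Sj) , second≡v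

    decode-off-S : ∀ {v} → (∀ i → S i ≢ inj₁ v) → ∃[ s ] decode s ≡ inj₁ v
    decode-off-S {v} v∉S with covered (inj₁ v)
    ... | i , j , i<j , v∈w with off-S-is-middle i<j v∉S v∈w
    ... | Bi , Bj , middle≡v with select-complete inB i Bi | select-complete inB j Bj
    ... | x , selx≡i | y , sely≡j = inj₂ (codeOf (x , y , x<y)) , (begin
        decode (inj₂ (codeOf (x , y , x<y)))
          ≡⟨ cong (λ (p : Pair (count inB)) → middle (select-mono inB (proj₂ (proj₂ p))))
                  (strictlyInverseˡ (x , y , x<y)) ⟩
        middle (select-mono inB x<y)  ≡⟨ middle-cong _ i<j selx≡i sely≡j ⟩
        middle i<j                    ≡⟨ middle≡v ⟩
        inj₁ v                        ∎)
      where
      open ≡-Reasoning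
      x<y : x < y
      x<y = mono⇒reflects-< (select-mono inB) (subst₂ _<_ (sym selx≡i) (sym sely≡j) i<j)

    decode-covers-A : ∀ v → ∃[ s ] decode s ≡ inj₁ v
    decode-covers-A v with any? (λ i → ≡-dec _≟_ _≟_ (S i) (inj₁ v))
    ... | yes (i , Si≡v) = decode-S Si≡v
    ... | no  v∉S        = decode-off-S λ i Si≡v → v∉S (i , Si≡v)

  strongGeodeticSet-bound : ∃[ a ] ∃[ b ] a + b ≡ k × b ≤ n₂ × n₁ ≤ a + b C 2
  strongGeodeticSet-bound = count inA , count inB , sizes , B-count , A-count
    where
    sizes : count inA + count inB ≡ k
    sizes = trans (+-comm (count inA) (count inB)) (count+count-not inB)

    B-count : count inB ≤ n₂
    B-count = injective⇒≤ {f = λ x → proj₁ (isB⇒inj₂ (select-sound inB x))} λ {x} {y} qx≡qy →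
      mono⇒injective (select-mono inB) (S-injective (begin
        S (select inB x) ≡⟨ proj₂ (isB⇒inj₂ (select-sound inB x)) ⟩
        inj₂ _           ≡⟨ cong inj₂ qx≡qy ⟩
        inj₂ _           ≡⟨ proj₂ (isB⇒inj₂ (select-sound inB y)) ⟨
        S (select inB y) ∎))
      where open ≡-Reasoning

    A-count : n₁ ≤ count inA + count inB C 2
    A-count = covering⇒≤ (decode ∘ splitAt _) inj₁ inj₁-injective λ v →
      let (s , decode-s≡v) = decode-covers-A v
      in join _ _ s , trans (cong decode (splitAt-join _ _ s)) decode-s≡v

module KGeodesics {n₁ n₂} (midA : Fin n₂ → Fin n₂ → Fin n₁) (midB : Fin n₁ → Fin n₁ → Fin n₂)
  where

  geodesic : (x y : Fin n₁ ⊎ Fin n₂) → x ≢ y → Geodesic (K n₁ n₂) x y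
  geodesic (inj₁ p) (inj₁ p′) ne = twoStep-geodesic (K n₁ n₂) (inj₂ (midB p p′)) ne (λ ()) tt tt
  geodesic (inj₁ p) (inj₂ q)  ne = edge-geodesic (K n₁ n₂) ne tt
  geodesic (inj₂ q) (inj₁ p)  ne = edge-geodesic (K n₁ n₂) ne tt
  geodesic (inj₂ q) (inj₂ q′) ne = twoStep-geodesic (K n₁ n₂) (inj₁ (midA q q′)) ne (λ ()) tt tt

  midA∈geodesic : ∀ {x y q q′} (x≢y : x ≢ y) → x ≡ inj₂ q → y ≡ inj₂ q′ →
                  inj₁ (midA q q′) ∈ verts (K n₁ n₂) (proj₁ (geodesic x y x≢y))
  midA∈geodesic _ refl refl = there (here refl)

  geodesicsBetween : ∀ {k} (S : Fin k → Fin n₁ ⊎ Fin n₂) → Injective _≡_ _≡_ S →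
                     (i j : Fin k) → i < j → Geodesic (K n₁ n₂) (S i) (S j)
  geodesicsBetween S S-injective i j i<j =
    geodesic (S i) (S j) (λ Si≡Sj → <-irrefl (S-injective Si≡Sj) i<j)

strongGeodeticSet-K-2 : ∀ {n} → 3 ≤ n → HasStrongGeodeticSetOfSize (K n 2) n
strongGeodeticSet-K-2 {n} (s≤s (s≤s (s≤s _))) = inj₁ , inj₁-injective , g , covered
  where
  midB : Fin n → Fin n → Fin 2
  midB _ (suc zero) = zero
  midB _ _          = suc zero

  open KGeodesics (λ _ _ → zero) midB

  g : (i j : Fin n) → i < j → Geodesic (K n 2) (inj₁ i) (inj₁ j)
  g = geodesicsBetween inj₁ inj₁-injective

  covered : ∀ v → CoveredBy (K n 2) inj₁ g v
  covered (inj₁ p)          = endpoint-covered (K n 2) inj₁ (s≤s (s≤s z≤n)) g p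
  covered (inj₂ zero)       = zero , suc zero , z<s , there (here refl)
  covered (inj₂ (suc zero)) = zero , suc (suc zero) , z<s , there (here refl)

strongGeodeticSet-K : ∀ a {n} → 2 ≤ n → HasStrongGeodeticSetOfSize (K (a + n C 2) n) (a + n)
strongGeodeticSet-K a {n@(suc (suc _))} 2≤n@(s≤s (s≤s z≤n)) = S , S-injective , g , covered
  where
  open Inverse (pairs↔ n) using (strictlyInverseʳ) renaming (to to pairOf; from to codeOf)

  embed : Fin a ⊎ Fin n → Fin (a + n C 2) ⊎ Fin n
  embed = map₁ (_↑ˡ n C 2)

  embed-injective : Injective _≡_ _≡_ embed
  embed-injective {inj₁ c} {inj₁ c′} eq = cong inj₁ (↑ˡ-injective (n C 2) c c′ (inj₁-injective eq))
  embed-injective {inj₂ q} {inj₂ q′} eq = cong inj₂ (inj₂-injective eq)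

  S : Fin (a + n) → Fin (a + n C 2) ⊎ Fin n
  S = embed ∘ splitAt a

  S-injective : Injective _≡_ _≡_ S
  S-injective = splitAt-injective a ∘ embed-injective

  S-join : ∀ s → S (join a n s) ≡ embed s
  S-join s = cong embed (splitAt-join a n s)

  -- Only q < q′ occurs, as S preserves the order of the n₂-side; the other value is junk.
  midA : Fin n → Fin n → Fin (a + n C 2)
  midA q q′ with q <? q′
  ... | yes q<q′ = a ↑ʳ codeOf (q , q′ , q<q′)
  ... | no  _    = a ↑ʳ codeOf (zero , suc zero , z<s)

  midA-< : ∀ {q q′} (q<q′ : q < q′) → midA q q′ ≡ a ↑ʳ codeOf (q , q′ , q<q′)
  midA-< {q} {q′} q<q′ with q <? q′
  ... | yes q<q′₁ = cong (λ lt → a ↑ʳ codeOf (q , q′ , lt)) (<-irrelevant q<q′₁ q<q′)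
  ... | no  q≮q′  = contradiction q<q′ q≮q′

  open KGeodesics midA (λ _ _ → zero)

  Kₐ : Graph
  Kₐ = K (a + n C 2) n

  g : (i j : Fin (a + n)) → i < j → Geodesic Kₐ (S i) (S j)
  g = geodesicsBetween S S-injective

  covered-S : ∀ s → CoveredBy Kₐ S g (embed s)
  covered-S s = subst (CoveredBy Kₐ S g) (S-join s)
    (endpoint-covered Kₐ S (≤-trans 2≤n (m≤n+m n a)) g (join a n s))

  covered-pair : ∀ c → CoveredBy Kₐ S g (inj₁ (a ↑ʳ c))
  covered-pair c = a ↑ʳ q , a ↑ʳ q′ , i<j ,
    subst (λ u → inj₁ u ∈ verts Kₐ (proj₁ (g (a ↑ʳ q) (a ↑ʳ q′) i<j)))
          (trans (midA-< q<q′) (cong (a ↑ʳ_) (strictlyInverseʳ c)))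
          (midA∈geodesic _ (S-join (inj₂ q)) (S-join (inj₂ q′)))
    where
    q q′ : Fin n
    q    = proj₁ (pairOf c)
    q′   = proj₁ (proj₂ (pairOf c))

    q<q′ : q < q′
    q<q′ = proj₂ (proj₂ (pairOf c))

    i<j : a ↑ʳ q < a ↑ʳ q′
    i<j = ↑ʳ-mono-< a q<q′

  covered-A : ∀ s → CoveredBy Kₐ S g (inj₁ (join a (n C 2) s))
  covered-A (inj₁ c) = covered-S (inj₁ c)
  covered-A (inj₂ c) = covered-pair c

  covered : ∀ v → CoveredBy Kₐ S g v
  covered (inj₁ p) =
    subst (CoveredBy Kₐ S g ∘ inj₁) (join-splitAt a (n C 2) p) (covered-A (splitAt a p))
  covered (inj₂ q) = covered-S (inj₂ q)

strongGeodeticSet-K-2-bound : ∀ {n k} → HasStrongGeodeticSetOfSize (K n 2) k → n ≤ k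
strongGeodeticSet-K-2-bound sgs with strongGeodeticSet-bound sgs
... | a , b , a+b≡k , b≤2 , n≤a+bC2 =
  ≤-trans n≤a+bC2 (≤-trans (+-monoʳ-≤ a (mC2≤m b≤2)) (≤-reflexive a+b≡k))

strongGeodeticSet-K-bound : ∀ {n₁ n₂ k} → 3 ≤ n₂ → HasStrongGeodeticSetOfSize (K n₁ n₂) k →
                            n₁ + n₂ ≤ n₂ C 2 + k
strongGeodeticSet-K-bound {n₁} {n₂} {k} 3≤n₂ sgs with strongGeodeticSet-bound sgs
... | a , b , a+b≡k , b≤n₂ , n₁≤a+bC2 = begin
  n₁ + n₂            ≤⟨ +-monoˡ-≤ n₂ n₁≤a+bC2 ⟩
  a + b C 2 + n₂     ≡⟨ +-assoc a (b C 2) n₂ ⟩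
  a + (b C 2 + n₂)   ≤⟨ +-monoʳ-≤ a (mC2+n≤m+nC2 3≤n₂ b≤n₂) ⟩
  a + (b + n₂ C 2)   ≡⟨ +-assoc a b (n₂ C 2) ⟨
  a + b + n₂ C 2     ≡⟨ +-comm (a + b) (n₂ C 2) ⟩
  n₂ C 2 + (a + b)   ≡⟨ cong (n₂ C 2 +_) a+b≡k ⟩
  n₂ C 2 + k         ∎
  where open ≤-Reasoning

proposition2p4 : (n₁ n₂ : ℕ) → 2 ≤ n₁ → 2 ≤ n₂ →
    n₁ ≤ (n₁ ∸ (n₂ C 2)) C 2 →
    (n₂ ≡ 2 → StrongGeodeticNumber (K n₁ n₂) n₁) ×
    (3 ≤ n₂ → StrongGeodeticNumber (K n₁ n₂) ((n₁ + n₂) ∸ (n₂ C 2)))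
proposition2p4 n₁ n₂ 2≤n₁ 2≤n₂ n₁≤[n₁∸n₂C2]C2 = case-2 , case-≥3
  where
  n≤[n∸1]C2⇒3≤n : ∀ {n} → 2 ≤ n → n ≤ (n ∸ 1) C 2 → 3 ≤ n
  n≤[n∸1]C2⇒3≤n {2}                 _ ()
  n≤[n∸1]C2⇒3≤n {suc (suc (suc _))} _ _ = s≤s (s≤s (s≤s z≤n))

  case-2 : n₂ ≡ 2 → StrongGeodeticNumber (K n₁ n₂) n₁
  case-2 refl = strongGeodeticSet-K-2 (n≤[n∸1]C2⇒3≤n 2≤n₁ n₁≤[n₁∸n₂C2]C2) ,
                λ _ → strongGeodeticSet-K-2-bound

  case-≥3 : 3 ≤ n₂ → StrongGeodeticNumber (K n₁ n₂) ((n₁ + n₂) ∸ (n₂ C 2))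
  case-≥3 3≤n₂ =
    subst₂ (λ n k → HasStrongGeodeticSetOfSize (K n n₂) k)
           (m∸n+n≡m n₂C2≤n₁) (sym (+-∸-comm n₂ n₂C2≤n₁)) (strongGeodeticSet-K (n₁ ∸ n₂ C 2) 2≤n₂) ,
    λ _ sgs → m≤n+o⇒m∸n≤o (n₁ + n₂) (n₂ C 2) (strongGeodeticSet-K-bound 3≤n₂ sgs)
    where
    n₂C2≤n₁ : n₂ C 2 ≤ n₁
    n₂C2≤n₁ = n≤[n∸m]C2⇒m≤n (≤-trans (s≤s z≤n) 2≤n₁) n₁≤[n₁∸n₂C2]C2
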